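{- Let $p$ be an odd prime and let $c\in GF(p)\setminus\{0\}$ be a nonsquare if $p\equiv 1 \pmod 4$ and a nonzero square if $p\equiv 3\pmod 4$. For $k\in\{1,\dots,p-1\}$ let $O_k\subset PG(2,p)$ be the conic $x^2+ky^2+ckz^2=0$. Let $P=(1,P_2,P_3)$ and $Q=(1,Q_2,Q_3)$ be distinct points of $O_\beta$ such that the point $(1,0,0)$ does not lie on the line through $P$ and $Q$. Then there exists $\alpha\in\{1,\dots,p-1\}$, $\alpha\neq\beta$, such that the line through $P$ and $Q$ is a tangent of $O_\alpha$, and its contact point is $(2,P_2+Q_2,P_3+Q_3)$.
   Context: $PG(2,p)$ is the projective plane over $GF(p)$ with homogeneous coordinates; every point of $O_k$ has nonzero first coordinate and so can be written $(1,y,z)$. A tangent of a conic is a line meeting it in exactly one point (its contact point). -}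

module Defs where

open import Data.Nat as ℕ using (ℕ; NonZero; _%_)
open import Data.Nat.DivMod using (_mod_)
open import Data.Fin using (Fin; toℕ)
open import Data.Product using (_×_; _,_; ∃; ∃-syntax)
open import Relation.Binary.PropositionalEquality using (_≡_)
open import Relation.Nullary using (¬_)

module _ {p : ℕ} .{{_ : NonZero p}} where

  infixl 6 _+F_
  infixl 7 _*F_

  ι : ℕ → Fin p
  ι n = n mod p

  _+F_ : Fin p → Fin p → Fin p
  a +F b = ι (toℕ a ℕ.+ toℕ b)

  _*F_ : Fin p → Fin p → Fin p
  a *F b = ι (toℕ a ℕ.* toℕ b)

  0F 1F 2F : Fin p
  0F = ι 0
  1F = ι 1
  2F = ι 2

  IsSquare : Fin p → Set
  IsSquare c = ∃[ x ] x *F x ≡ c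

  -- homogeneous coordinate vectors of PG(2,p)
  V3 : Set
  V3 = Fin p × Fin p × Fin p

  NonZeroV : V3 → Set
  NonZeroV (x , y , z) = ¬ (x ≡ 0F × y ≡ 0F × z ≡ 0F)

  scale : Fin p → V3 → V3
  scale t (x , y , z) = (t *F x , t *F y , t *F z)

  addV : V3 → V3 → V3
  addV (x , y , z) (x' , y' , z') = (x +F x' , y +F y' , z +F z')

  SamePoint : V3 → V3 → Set
  SamePoint u v = ∃[ t ] (¬ t ≡ 0F × v ≡ scale t u)

  OnConic : (c k : Fin p) → V3 → Set
  OnConic c k (x , y , z) = x *F x +F k *F (y *F y) +F c *F k *F (z *F z) ≡ 0F

  OnLine : (P Q X : V3) → Set
  OnLine P Q X = ∃[ s ] ∃[ t ] X ≡ addV (scale s P) (scale t Q)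

  TangentAt : (c k : Fin p) (P Q T : V3) → Set
  TangentAt c k P Q T =
    NonZeroV T × OnLine P Q T × OnConic c k T ×
    (∀ X → NonZeroV X → OnLine P Q X → OnConic c k X → SamePoint T X)

module Submission where

open import Defs
open import Data.Nat using (ℕ; NonZero; _%_)
open import Data.Nat.Primality using (Prime)
open import Data.Fin using (Fin)
open import Data.Product using (_×_; _,_; ∃; ∃-syntax)
open import Relation.Binary.PropositionalEquality using (_≡_)
open import Relation.Nullary using (¬_)

open import Algebra.Bundles using (CommutativeRing; RawRing)
open import Algebra.Structures using (IsCommutativeRing)
open import Algebra.Solver.Ring.AlmostCommutativeRing
  using (_-Raw-AlmostCommutative⟶_; fromCommutativeRing)
import Algebra.Solver.Ring as RingSolver
import Algebra.Solver.Ring.NaturalCoefficients.Default as SemiringSolver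
open import Data.Empty using (⊥-elim)
open import Data.Fin as Fin using (toℕ)
open import Data.Fin.Properties using (toℕ-fromℕ<; toℕ-injective; toℕ<n)
open import Data.List using (List; []; _∷_; length; foldr; filter; allFin)
open import Data.List.Properties using (filter-accept; filter-reject; filter-all; length-tabulate)
open import Data.List.Membership.Propositional using (_∈_; _∉_)
open import Data.List.Membership.Propositional.Properties using (∈-filter⁺; ∈-filter⁻; ∈-allFin)
open import Data.List.Relation.Unary.Any using (here; there)
open import Data.List.Relation.Unary.All as All using ([]; _∷_)
open import Data.List.Relation.Unary.All.Properties using (All¬⇒¬Any)
open import Data.List.Relation.Unary.Unique.Propositional using (Unique; []; _∷_)
import Data.List.Relation.Unary.Unique.Propositional.Properties as Unique
open import Data.Maybe using (Maybe; just; nothing)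
open import Data.Nat as ℕ using (zero; suc; _∸_; _≤_; s≤s)
open import Data.Nat.Coprimality using (Coprime; coprime-Bézout)
open import Data.Nat.DivMod
  using (m%n<n; %-distribˡ-+; %-distribˡ-*; m<n⇒m%n≡m; n%n≡0; [m+kn]%n≡m%n; m∣n⇒o%n%m≡o%m)
open import Data.Nat.Divisibility
  using (_∣_; divides; ∣⇒≤; m%n≡0⇒n∣m; n∣m⇒m%n≡0; ∣m∣n⇒∣m+n; ∣-refl)
open import Data.Nat.GCD using (module Bézout)
import Data.Nat.Properties as ℕP
open import Data.Nat.Primality using (euclidsLemma; prime⇒irreducible; prime⇒nonTrivial)
open import Data.Product using (proj₁; proj₂)
open import Data.Sum using (_⊎_; inj₁; inj₂; [_,_]′)
open import Function using (_∘_)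
open import Relation.Binary.Definitions using (DecidableEquality)
open import Relation.Binary.PropositionalEquality
  using (refl; sym; trans; cong; cong₂; subst; isEquivalence; module ≡-Reasoning)
open import Relation.Nullary using (Dec; yes; no; ¬?)

-- Write N(y,z) = y² + c z², so a point (1,y,z) lies on O_β iff β N(y,z) = −1.
-- For P, Q ∈ O_β let g = P₂Q₂ + c P₃Q₃ be the polar form of N, d = 1 − βg and
-- α = 2β/d.  On the line sP + tQ, β times the form of O_α equals
-- (β − α)(s − t)², so the line meets O_α only where s = t, i.e. at
-- T = P + Q = (2, P₂+Q₂, P₃+Q₃): PQ is the tangent of O_α at T.  The side
-- conditions d ≠ 0 and α ≠ β amount to N(P + Q) ≠ 0 and N(P − Q) ≠ 0, which
-- follow from (1,0,0) ∉ PQ and P ≠ Q once N is anisotropic, i.e. once −c is a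
-- nonsquare.  The hypothesis on c gives this because −1 is a square in GF(p)
-- iff p ≡ 1 (mod 4), proved by counting orbits of the Klein four-group
-- generated by x ↦ −x and x ↦ x⁻¹ on GF(p).

module Deletion {A : Set} (_≟_ : DecidableEquality A) where

  delete : A → List A → List A
  delete a = filter (λ y → ¬? (y ≟ a))

  ∈-delete⁺ : ∀ {a y xs} → y ∈ xs → ¬ y ≡ a → y ∈ delete a xs
  ∈-delete⁺ {a} = ∈-filter⁺ (λ y → ¬? (y ≟ a))

  ∈-delete⁻ : ∀ {a y xs} → y ∈ delete a xs → y ∈ xs × ¬ y ≡ a
  ∈-delete⁻ {a} = ∈-filter⁻ (λ y → ¬? (y ≟ a))

  length-delete : ∀ {a xs} → Unique xs → a ∈ xs → length xs ≡ suc (length (delete a xs))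
  length-delete {a} {x ∷ xs} (x∉xs ∷ _) (here refl) =
    cong suc (sym (trans (cong length (filter-reject (λ y → ¬? (y ≟ a)) λ x≢x → x≢x refl))
                         (cong length (filter-all _ (All.map (λ x≢y y≡x → x≢y (sym y≡x)) x∉xs)))))
  length-delete {a} {x ∷ xs} (x∉xs ∷ u) (there a∈xs) =
    trans (cong suc (length-delete u a∈xs))
          (cong (suc ∘ length) (sym (filter-accept (λ y → ¬? (y ≟ a)) {x} {xs} x≢a)))
    where
      x≢a : ¬ x ≡ a
      x≢a = All.lookup x∉xs a∈xs

  deleteAll : List A → List A → List A
  deleteAll E xs = foldr delete xs E

  ∈-deleteAll⁺ : ∀ {y} E {xs} → y ∈ xs → y ∉ E → y ∈ deleteAll E xs
  ∈-deleteAll⁺ []      y∈xs _   = y∈xs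
  ∈-deleteAll⁺ (e ∷ E) y∈xs y∉E =
    ∈-delete⁺ (∈-deleteAll⁺ E y∈xs (y∉E ∘ there)) (y∉E ∘ here)

  ∈-deleteAll⁻ : ∀ {y} E {xs} → y ∈ deleteAll E xs → y ∈ xs × y ∉ E
  ∈-deleteAll⁻ []      y∈xs = y∈xs , λ ()
  ∈-deleteAll⁻ (e ∷ E) y∈ with ∈-delete⁻ y∈
  ... | y∈′ , y≢e with ∈-deleteAll⁻ E y∈′
  ... | y∈xs , y∉E = y∈xs , λ { (here y≡e) → y≢e y≡e ; (there y∈E) → y∉E y∈E }

  deleteAll-unique : ∀ E {xs} → Unique xs → Unique (deleteAll E xs)
  deleteAll-unique []      u = u
  deleteAll-unique (e ∷ E) u = Unique.filter⁺ (λ y → ¬? (y ≟ e)) (deleteAll-unique E u)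

  length-deleteAll : ∀ {E xs} → Unique E → Unique xs → (∀ {e} → e ∈ E → e ∈ xs) →
    length xs ≡ length E ℕ.+ length (deleteAll E xs)
  length-deleteAll {[]}    _            _   _    = refl
  length-deleteAll {e ∷ E} {xs} (e∉E ∷ uE) uxs E⊆xs = begin
    length xs                                          ≡⟨ length-deleteAll uE uxs (E⊆xs ∘ there) ⟩
    length E ℕ.+ length (deleteAll E xs)               ≡⟨ cong (length E ℕ.+_) (length-delete
                                                            (deleteAll-unique E uxs) e∈deleteAll) ⟩
    length E ℕ.+ suc (length (deleteAll (e ∷ E) xs))   ≡⟨ ℕP.+-suc _ _ ⟩
    suc (length E ℕ.+ length (deleteAll (e ∷ E) xs))   ∎
    where
      open ≡-Reasoning
      e∈deleteAll : e ∈ deleteAll E xs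
      e∈deleteAll = ∈-deleteAll⁺ E (E⊆xs (here refl)) (All¬⇒¬Any e∉E)

module KleinOrbits {A : Set} (_≟_ : DecidableEquality A) (f g : A → A)
    (f-involutive : ∀ x → f (f x) ≡ x) (g-involutive : ∀ x → g (g x) ≡ x)
    (fg≡gf : ∀ x → f (g x) ≡ g (f x)) where

  open Deletion _≟_

  orbit : A → List A
  orbit x = x ∷ f x ∷ g x ∷ f (g x) ∷ []

  Free : A → Set
  Free x = Unique (orbit x)

  Closed : (A → A) → List A → Set
  Closed h S = ∀ {y} → y ∈ S → h y ∈ S

  orbit-closed-f : ∀ x → Closed f (orbit x)
  orbit-closed-f x (here refl)                         = there (here refl)
  orbit-closed-f x (there (here refl))                 = here (f-involutive x)
  orbit-closed-f x (there (there (here refl)))         = there (there (there (here refl)))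
  orbit-closed-f x (there (there (there (here refl)))) = there (there (here (f-involutive (g x))))

  orbit-closed-g : ∀ x → Closed g (orbit x)
  orbit-closed-g x (here refl)                         = there (there (here refl))
  orbit-closed-g x (there (here refl))                 = there (there (there (here (sym (fg≡gf x)))))
  orbit-closed-g x (there (there (here refl)))         = here (g-involutive x)
  orbit-closed-g x (there (there (there (here refl)))) =
    there (here (trans (cong g (fg≡gf x)) (g-involutive (f x))))

  orbit-⊆ : ∀ {x L} → Closed f L → Closed g L → x ∈ L → ∀ {e} → e ∈ orbit x → e ∈ L
  orbit-⊆ cf cg x∈L (here refl)                         = x∈L
  orbit-⊆ cf cg x∈L (there (here refl))                 = cf x∈L
  orbit-⊆ cf cg x∈L (there (there (here refl)))         = cg x∈L
  orbit-⊆ cf cg x∈L (there (there (there (here refl)))) = cf (cg x∈L)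

  -- Removing a set closed under an involution h from an h-closed list leaves an
  -- h-closed list: if h y were in the removed set, so would be y = h (h y).
  deleteAll-closed : ∀ {h E L} → (∀ x → h (h x) ≡ x) → Closed h E → Closed h L →
    Closed h (deleteAll E L)
  deleteAll-closed {h} {E} h-involutive closedE closedL {y} y∈ with ∈-deleteAll⁻ E y∈
  ... | y∈L , y∉E = ∈-deleteAll⁺ E (closedL y∈L)
    (λ hy∈E → y∉E (subst (_∈ E) (h-involutive y) (closedE hy∈E)))

  -- A duplicate-free list closed under f and g all of whose orbits are free
  -- is a disjoint union of four-element orbits, so 4 divides its length.
  -- (The first argument bounds the length, to make the recursion structural.)
  four∣length : ∀ n L → length L ≤ n → Unique L → Closed f L → Closed g L →
    (∀ {y} → y ∈ L → Free y) → 4 ∣ length L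
  four∣length n       []       _          _ _  _  _    = divides 0 refl
  four∣length zero    (_ ∷ _)  ()
  four∣length (suc n) L@(x ∷ _) (s≤s |L|≤n) u cf cg free =
    subst (4 ∣_) (sym |L|≡4+|L′|) (∣m∣n⇒∣m+n (∣-refl {4}) 4∣|L′|)
    where
      L′ : List A
      L′ = deleteAll (orbit x) L
      |L|≡4+|L′| : length L ≡ 4 ℕ.+ length L′
      |L|≡4+|L′| = length-deleteAll (free (here refl)) u (orbit-⊆ cf cg (here refl))
      -- |L′| = |L| − 4 < |L| ≤ n + 1
      |L′|≤n : length L′ ≤ n
      |L′|≤n = ℕP.≤-pred (ℕP.≤-trans (s≤s (ℕP.m≤n+m (length L′) 3))
                                     (ℕP.≤-trans (ℕP.≤-reflexive (sym |L|≡4+|L′|)) (s≤s |L|≤n)))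
      4∣|L′| : 4 ∣ length L′
      4∣|L′| = four∣length n L′ |L′|≤n (deleteAll-unique (orbit x) u)
        (deleteAll-closed f-involutive (orbit-closed-f x) cf)
        (deleteAll-closed g-involutive (orbit-closed-g x) cg)
        (λ y∈L′ → free (proj₁ (∈-deleteAll⁻ (orbit x) y∈L′)))

  length-mod4 : ∀ {E L} → Unique E → Unique L → (∀ y → y ∈ L) → Closed f E → Closed g E →
    (∀ {y} → y ∉ E → Free y) → length L % 4 ≡ length E % 4
  length-mod4 {E} {L} uE uL complete cfE cgE free
    with four∣length _ (deleteAll E L) ℕP.≤-refl (deleteAll-unique E uL)
           (deleteAll-closed f-involutive cfE (λ _ → complete _))
           (deleteAll-closed g-involutive cgE (λ _ → complete _))
           (λ y∈ → free (proj₂ (∈-deleteAll⁻ E y∈)))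
  ... | divides k |L′|≡k*4 = begin
    length L % 4                            ≡⟨ cong (_% 4) (length-deleteAll uE uL (λ _ → complete _)) ⟩
    (length E ℕ.+ length (deleteAll E L)) % 4 ≡⟨ cong (λ m → (length E ℕ.+ m) % 4) |L′|≡k*4 ⟩
    (length E ℕ.+ k ℕ.* 4) % 4               ≡⟨ [m+kn]%n≡m%n (length E) k 4 ⟩
    length E % 4                            ∎
    where open ≡-Reasoning

odd⇒1or3mod4 : ∀ n → ¬ 2 ∣ n → n % 4 ≡ 1 ⊎ n % 4 ≡ 3
odd⇒1or3mod4 n 2∤n with n % 4 | m%n<n n 4 | m∣n⇒o%n%m≡o%m 2 4 n (divides 2 refl)
... | 0 | _ | 0≡n%2 = ⊥-elim (2∤n (m%n≡0⇒n∣m n 2 (sym 0≡n%2)))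
... | 1 | _ | _     = inj₁ refl
... | 2 | _ | 0≡n%2 = ⊥-elim (2∤n (m%n≡0⇒n∣m n 2 (sym 0≡n%2)))
... | 3 | _ | _     = inj₂ refl
... | suc (suc (suc (suc _))) | s≤s (s≤s (s≤s (s≤s ()))) | _

module PrimeField (p : ℕ) .{{_ : NonZero p}} where

  F : Set
  F = Fin p

  infix 8 -F_

  -F_ : F → F
  -F a = ι (p ∸ toℕ a)

  -1F : F
  -1F = -F 1F

  toℕ-ι : ∀ n → toℕ (ι {p} n) ≡ n % p
  toℕ-ι n = toℕ-fromℕ< (m%n<n n p)

  ι-cong : ∀ {m n} → m % p ≡ n % p → ι {p} m ≡ ι n
  ι-cong {m} {n} eq = toℕ-injective (trans (toℕ-ι m) (trans eq (sym (toℕ-ι n))))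

  ι-toℕ : ∀ (a : F) → ι (toℕ a) ≡ a
  ι-toℕ a = toℕ-injective (trans (toℕ-ι (toℕ a)) (m<n⇒m%n≡m (toℕ<n a)))

  ι-+ : ∀ m n → ι (m ℕ.+ n) ≡ ι m +F ι n
  ι-+ m n = trans (ι-cong (%-distribˡ-+ m n p))
    (sym (cong₂ (λ a b → ι (a ℕ.+ b)) (toℕ-ι m) (toℕ-ι n)))

  ι-* : ∀ m n → ι (m ℕ.* n) ≡ ι m *F ι n
  ι-* m n = trans (ι-cong (%-distribˡ-* m n p))
    (sym (cong₂ (λ a b → ι (a ℕ.* b)) (toℕ-ι m) (toℕ-ι n)))

  ι-p : ι {p} p ≡ 0F
  ι-p = ι-cong (trans (n%n≡0 p) (sym (m<n⇒m%n≡m (ℕ.>-nonZero⁻¹ p))))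

  -- Since ι is onto, an identity between field operations holds as soon as
  -- it holds on all values ι x.

  onto₁ : {f g : F → F} → (∀ x → f (ι x) ≡ g (ι x)) → ∀ a → f a ≡ g a
  onto₁ {f} {g} h a = subst (λ u → f u ≡ g u) (ι-toℕ a) (h (toℕ a))

  onto₃ : {f g : F → F → F → F} →
    (∀ x y z → f (ι x) (ι y) (ι z) ≡ g (ι x) (ι y) (ι z)) → ∀ a b c → f a b c ≡ g a b c
  onto₃ {f} {g} h a b c = onto₁ {λ u → f u b c} {λ u → g u b c} (λ x →
    onto₁ {λ u → f (ι x) u c} {λ u → g (ι x) u c} (λ y →
    onto₁ {f (ι x) (ι y)} {g (ι x) (ι y)} (h x y) c) b) a

  open ≡-Reasoning

  +F-assoc : ∀ a b c → (a +F b) +F c ≡ a +F (b +F c)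
  +F-assoc = onto₃ λ x y z → begin
    (ι x +F ι y) +F ι z  ≡⟨ cong (_+F ι z) (sym (ι-+ x y)) ⟩
    ι (x ℕ.+ y) +F ι z   ≡⟨ sym (ι-+ _ z) ⟩
    ι (x ℕ.+ y ℕ.+ z)    ≡⟨ cong ι (ℕP.+-assoc x y z) ⟩
    ι (x ℕ.+ (y ℕ.+ z))  ≡⟨ ι-+ x _ ⟩
    ι x +F ι (y ℕ.+ z)   ≡⟨ cong (ι x +F_) (ι-+ y z) ⟩
    ι x +F (ι y +F ι z)  ∎

  *F-assoc : ∀ a b c → (a *F b) *F c ≡ a *F (b *F c)
  *F-assoc = onto₃ λ x y z → begin
    (ι x *F ι y) *F ι z  ≡⟨ cong (_*F ι z) (sym (ι-* x y)) ⟩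
    ι (x ℕ.* y) *F ι z   ≡⟨ sym (ι-* _ z) ⟩
    ι (x ℕ.* y ℕ.* z)    ≡⟨ cong ι (ℕP.*-assoc x y z) ⟩
    ι (x ℕ.* (y ℕ.* z))  ≡⟨ ι-* x _ ⟩
    ι x *F ι (y ℕ.* z)   ≡⟨ cong (ι x *F_) (ι-* y z) ⟩
    ι x *F (ι y *F ι z)  ∎

  *F-distribʳ : ∀ a b c → (b +F c) *F a ≡ b *F a +F c *F a
  *F-distribʳ = onto₃ λ x y z → begin
    (ι y +F ι z) *F ι x          ≡⟨ cong (_*F ι x) (sym (ι-+ y z)) ⟩
    ι (y ℕ.+ z) *F ι x           ≡⟨ sym (ι-* _ x) ⟩
    ι ((y ℕ.+ z) ℕ.* x)          ≡⟨ cong ι (ℕP.*-distribʳ-+ x y z) ⟩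
    ι (y ℕ.* x ℕ.+ z ℕ.* x)      ≡⟨ ι-+ _ _ ⟩
    ι (y ℕ.* x) +F ι (z ℕ.* x)   ≡⟨ cong₂ _+F_ (ι-* y x) (ι-* z x) ⟩
    ι y *F ι x +F ι z *F ι x     ∎

  +F-comm : ∀ a b → a +F b ≡ b +F a
  +F-comm a b = cong ι (ℕP.+-comm (toℕ a) (toℕ b))

  *F-comm : ∀ a b → a *F b ≡ b *F a
  *F-comm a b = cong ι (ℕP.*-comm (toℕ a) (toℕ b))

  +F-identityˡ : ∀ a → 0F +F a ≡ a
  +F-identityˡ = onto₁ λ x → sym (ι-+ 0 x)

  +F-identityʳ : ∀ a → a +F 0F ≡ a
  +F-identityʳ a = trans (+F-comm a 0F) (+F-identityˡ a)

  *F-identityˡ : ∀ a → 1F *F a ≡ a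
  *F-identityˡ = onto₁ λ x → trans (sym (ι-* 1 x)) (cong ι (ℕP.*-identityˡ x))

  *F-identityʳ : ∀ a → a *F 1F ≡ a
  *F-identityʳ a = trans (*F-comm a 1F) (*F-identityˡ a)

  *F-distribˡ : ∀ a b c → a *F (b +F c) ≡ a *F b +F a *F c
  *F-distribˡ a b c =
    trans (*F-comm a _) (trans (*F-distribʳ a b c) (cong₂ _+F_ (*F-comm b a) (*F-comm c a)))

  -F-inverseˡ : ∀ a → (-F a) +F a ≡ 0F
  -F-inverseˡ a = begin
    ι (p ∸ toℕ a) +F a            ≡⟨ cong (ι (p ∸ toℕ a) +F_) (sym (ι-toℕ a)) ⟩
    ι (p ∸ toℕ a) +F ι (toℕ a)    ≡⟨ sym (ι-+ _ _) ⟩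
    ι (p ∸ toℕ a ℕ.+ toℕ a)       ≡⟨ cong ι (ℕP.m∸n+n≡m (ℕP.<⇒≤ (toℕ<n a))) ⟩
    ι p                           ≡⟨ ι-p ⟩
    0F                            ∎

  -F-inverseʳ : ∀ a → a +F (-F a) ≡ 0F
  -F-inverseʳ a = trans (+F-comm a _) (-F-inverseˡ a)

  isCommutativeRing : IsCommutativeRing _≡_ _+F_ _*F_ -F_ 0F 1F
  isCommutativeRing = record
    { isRing = record
      { +-isAbelianGroup = record
        { isGroup = record
          { isMonoid = record
            { isSemigroup = record
              { isMagma = record { isEquivalence = isEquivalence ; ∙-cong = cong₂ _+F_ }
              ; assoc = +F-assoc }
            ; identity = +F-identityˡ , +F-identityʳ }
          ; inverse = -F-inverseˡ , -F-inverseʳ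
          ; ⁻¹-cong = cong -F_ }
        ; comm = +F-comm }
      ; *-cong = cong₂ _*F_
      ; *-assoc = *F-assoc
      ; *-identity = *F-identityˡ , *F-identityʳ
      ; distrib = *F-distribˡ , *F-distribʳ }
    ; *-comm = *F-comm }

  commutativeRing : CommutativeRing _ _
  commutativeRing = record { isCommutativeRing = isCommutativeRing }

  open CommutativeRing commutativeRing public using (zeroˡ; zeroʳ)
  open import Algebra.Properties.Ring (CommutativeRing.ring commutativeRing) public
    using (+-cancelʳ; +-inverseˡ-unique; x∙y⁻¹≈ε⇒x≈y; -‿involutive; -‿injective; -0#≈0#)

  -- The solver's constants are formal differences
  -- a − b of naturals, kept normalised (one side 0) so that equal integer
  -- constants are syntactically equal; the interpretation sends (n , 0) to ι n
  -- on the nose, so constants in solved equations appear as 0F, 1F, 2F, ...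

  Diff : Set
  Diff = ℕ × ℕ

  ⟦_⟧ᵈ : Diff → F
  ⟦ (a , zero) ⟧ᵈ  = ι a
  ⟦ (a , suc b) ⟧ᵈ = ι a +F -F ι (suc b)

  ⟦⟧ᵈ-spec : ∀ a b → ⟦ (a , b) ⟧ᵈ +F ι b ≡ ι a
  ⟦⟧ᵈ-spec a zero        = +F-identityʳ (ι a)
  ⟦⟧ᵈ-spec a b@(suc _)  = trans (+F-assoc (ι a) _ _)
    (trans (cong (ι a +F_) (-F-inverseˡ (ι b))) (+F-identityʳ (ι a)))

  ⟦⟧ᵈ-unique : ∀ {x} a b → x +F ι b ≡ ι a → x ≡ ⟦ (a , b) ⟧ᵈ
  ⟦⟧ᵈ-unique a b eq = +-cancelʳ (ι b) _ _ (trans eq (sym (⟦⟧ᵈ-spec a b)))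

  normalise : Diff → Diff
  normalise (a , b) = (a ∸ b , b ∸ a)

  normalise-sound : ∀ a b → ⟦ normalise (a , b) ⟧ᵈ ≡ ⟦ (a , b) ⟧ᵈ
  normalise-sound a b with ℕP.≤-total b a
  ... | inj₁ b≤a = ⟦⟧ᵈ-unique a b (begin
    x +F ι b                    ≡⟨ cong (_+F ι b) (+F-identityʳ x) ⟨
    x +F 0F +F ι b              ≡⟨ cong (λ m → x +F ι m +F ι b) (ℕP.m≤n⇒m∸n≡0 b≤a) ⟨
    x +F ι (b ∸ a) +F ι b      ≡⟨ cong (_+F ι b) (⟦⟧ᵈ-spec (a ∸ b) (b ∸ a)) ⟩
    ι (a ∸ b) +F ι b           ≡⟨ ι-+ _ _ ⟨
    ι (a ∸ b ℕ.+ b)            ≡⟨ cong ι (ℕP.m∸n+n≡m b≤a) ⟩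
    ι a                         ∎)
    where x = ⟦ normalise (a , b) ⟧ᵈ
  ... | inj₂ a≤b = ⟦⟧ᵈ-unique a b (begin
    x +F ι b                    ≡⟨ cong (λ m → x +F ι m) (ℕP.m∸n+n≡m a≤b) ⟨
    x +F ι (b ∸ a ℕ.+ a)       ≡⟨ cong (x +F_) (ι-+ _ _) ⟩
    x +F (ι (b ∸ a) +F ι a)    ≡⟨ +F-assoc x _ _ ⟨
    x +F ι (b ∸ a) +F ι a      ≡⟨ cong (_+F ι a) (⟦⟧ᵈ-spec (a ∸ b) (b ∸ a)) ⟩
    ι (a ∸ b) +F ι a           ≡⟨ cong (λ m → ι m +F ι a) (ℕP.m≤n⇒m∸n≡0 a≤b) ⟩
    0F +F ι a                   ≡⟨ +F-identityˡ _ ⟩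
    ι a                         ∎)
    where x = ⟦ normalise (a , b) ⟧ᵈ

  _⊕_ _⊗_ : Diff → Diff → Diff
  (a , b) ⊕ (c , d) = normalise (a ℕ.+ c , b ℕ.+ d)
  (a , b) ⊗ (c , d) = normalise (a ℕ.* c ℕ.+ b ℕ.* d , a ℕ.* d ℕ.+ b ℕ.* c)

  ⊝_ : Diff → Diff
  ⊝ (a , b) = (b , a)

  module Semiring = SemiringSolver (CommutativeRing.commutativeSemiring commutativeRing)

  ⊕-homo : ∀ x y → ⟦ x ⊕ y ⟧ᵈ ≡ ⟦ x ⟧ᵈ +F ⟦ y ⟧ᵈ
  ⊕-homo (a , b) (c , d) = trans (normalise-sound (a ℕ.+ c) (b ℕ.+ d))
    (sym (⟦⟧ᵈ-unique (a ℕ.+ c) (b ℕ.+ d) (begin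
      (u +F v) +F ι (b ℕ.+ d)     ≡⟨ cong ((u +F v) +F_) (ι-+ b d) ⟩
      (u +F v) +F (ι b +F ι d)    ≡⟨ solve 4 (λ u v b d → (u :+ v) :+ (b :+ d) := (u :+ b) :+ (v :+ d))
                                           refl u v (ι b) (ι d) ⟩
      (u +F ι b) +F (v +F ι d)    ≡⟨ cong₂ _+F_ (⟦⟧ᵈ-spec a b) (⟦⟧ᵈ-spec c d) ⟩
      ι a +F ι c                  ≡⟨ ι-+ a c ⟨
      ι (a ℕ.+ c)                 ∎)))
    where u = ⟦ (a , b) ⟧ᵈ
          v = ⟦ (c , d) ⟧ᵈ
          open Semiring

  ⊗-homo : ∀ x y → ⟦ x ⊗ y ⟧ᵈ ≡ ⟦ x ⟧ᵈ *F ⟦ y ⟧ᵈ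
  ⊗-homo (a , b) (c , d) = trans (normalise-sound (a ℕ.* c ℕ.+ b ℕ.* d) (a ℕ.* d ℕ.+ b ℕ.* c))
    (sym (⟦⟧ᵈ-unique (a ℕ.* c ℕ.+ b ℕ.* d) (a ℕ.* d ℕ.+ b ℕ.* c) (begin
      u *F v +F ι (a ℕ.* d ℕ.+ b ℕ.* c)
        ≡⟨ cong (u *F v +F_) (trans (ι-+ _ _) (cong₂ _+F_ (ι-* a d) (ι-* b c))) ⟩
      u *F v +F (ι a *F ι d +F ι b *F ι c)
        ≡⟨ cong₂ (λ x y → u *F v +F (x *F ι d +F ι b *F y)) (⟦⟧ᵈ-spec a b) (⟦⟧ᵈ-spec c d) ⟨
      u *F v +F ((u +F ι b) *F ι d +F ι b *F (v +F ι d))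
        ≡⟨ solve 4 (λ u v b d → u :* v :+ ((u :+ b) :* d :+ b :* (v :+ d))
                                      := (u :+ b) :* (v :+ d) :+ b :* d) refl u v (ι b) (ι d) ⟩
      (u +F ι b) *F (v +F ι d) +F ι b *F ι d
        ≡⟨ cong₂ (λ x y → x *F y +F ι b *F ι d) (⟦⟧ᵈ-spec a b) (⟦⟧ᵈ-spec c d) ⟩
      ι a *F ι c +F ι b *F ι d
        ≡⟨ trans (ι-+ _ _) (cong₂ _+F_ (ι-* a c) (ι-* b d)) ⟨
      ι (a ℕ.* c ℕ.+ b ℕ.* d) ∎)))
    where u = ⟦ (a , b) ⟧ᵈ
          v = ⟦ (c , d) ⟧ᵈ
          open Semiring

  ⊝-homo : ∀ x → ⟦ ⊝ x ⟧ᵈ ≡ -F ⟦ x ⟧ᵈ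
  ⊝-homo (a , b) = sym (⟦⟧ᵈ-unique b a (begin
    -F u +F ι a           ≡⟨ cong (-F u +F_) (⟦⟧ᵈ-spec a b) ⟨
    -F u +F (u +F ι b)    ≡⟨ +F-assoc _ _ _ ⟨
    -F u +F u +F ι b      ≡⟨ cong (_+F ι b) (-F-inverseˡ u) ⟩
    0F +F ι b             ≡⟨ +F-identityˡ _ ⟩
    ι b                   ∎))
    where u = ⟦ (a , b) ⟧ᵈ

  diffRawRing : RawRing _ _
  diffRawRing = record
    { Carrier = Diff ; _≈_ = _≡_ ; _+_ = _⊕_ ; _*_ = _⊗_ ; -_ = ⊝_ ; 0# = (0 , 0) ; 1# = (1 , 0) }

  ⟦⟧ᵈ-morphism : diffRawRing -Raw-AlmostCommutative⟶ fromCommutativeRing commutativeRing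
  ⟦⟧ᵈ-morphism = record
    { ⟦_⟧ = ⟦_⟧ᵈ ; +-homo = ⊕-homo ; *-homo = ⊗-homo ; -‿homo = ⊝-homo
    ; 0-homo = refl ; 1-homo = refl }

  -- Equality test on normalised constants (all the solver needs).
  diff≟ : ∀ x y → Maybe (⟦ x ⟧ᵈ ≡ ⟦ y ⟧ᵈ)
  diff≟ (a , b) (c , d) with a ℕ.≟ c | b ℕ.≟ d
  ... | yes refl | yes refl = just refl
  ... | _        | _        = nothing

  module Ring = RingSolver diffRawRing (fromCommutativeRing commutativeRing) ⟦⟧ᵈ-morphism diff≟

  K : ∀ {m} → ℕ → Ring.Polynomial m
  K n = Ring.con (n , 0)

  toℕ-0F : toℕ (0F {p}) ≡ 0
  toℕ-0F = trans (toℕ-ι 0) (m<n⇒m%n≡m (ℕ.>-nonZero⁻¹ p))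

  ι≡0⇒p∣ : ∀ n → ι {p} n ≡ 0F → p ∣ n
  ι≡0⇒p∣ n eq = m%n≡0⇒n∣m n p (trans (sym (toℕ-ι n)) (trans (cong toℕ eq) toℕ-0F))

  p∣⇒ι≡0 : ∀ n → p ∣ n → ι {p} n ≡ 0F
  p∣⇒ι≡0 n p∣n = ι-cong (trans (n∣m⇒m%n≡0 n p p∣n) (sym (m<n⇒m%n≡m (ℕ.>-nonZero⁻¹ p))))

  p∣toℕ⇒≡0 : ∀ (a : F) → p ∣ toℕ a → a ≡ 0F
  p∣toℕ⇒≡0 a p∣a with toℕ a in eq
  ... | zero  = toℕ-injective (trans eq (sym toℕ-0F))
  ... | suc _ = ⊥-elim (ℕP.<⇒≱ (subst (ℕ._< p) eq (toℕ<n a)) (∣⇒≤ p∣a))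

  module Field (p-prime : Prime p) where

    1F≢0F : ¬ (1F {p}) ≡ 0F
    1F≢0F eq = ℕP.<⇒≱ (ℕ.nonTrivial⇒n>1 p {{prime⇒nonTrivial p-prime}}) (∣⇒≤ (ι≡0⇒p∣ 1 eq))

    zero-divisor : ∀ (a b : F) → a *F b ≡ 0F → a ≡ 0F ⊎ b ≡ 0F
    zero-divisor a b ab≡0 with euclidsLemma (toℕ a) (toℕ b) p-prime (ι≡0⇒p∣ _ ab≡0)
    ... | inj₁ p∣a = inj₁ (p∣toℕ⇒≡0 a p∣a)
    ... | inj₂ p∣b = inj₂ (p∣toℕ⇒≡0 b p∣b)

    square≡0 : ∀ x → x *F x ≡ 0F → x ≡ 0F
    square≡0 x x²≡0 = [ (λ x≡0 → x≡0) , (λ x≡0 → x≡0) ]′ (zero-divisor x x x²≡0)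

    *F-nonzero : ∀ {a b : F} → ¬ a ≡ 0F → ¬ b ≡ 0F → ¬ a *F b ≡ 0F
    *F-nonzero {a} {b} a≢0 b≢0 ab≡0 = [ a≢0 , b≢0 ]′ (zero-divisor a b ab≡0)

    -- Bézout: a nonzero a is coprime to p, so x·a ≡ ±1 (mod p) for some x.
    inverse : ∀ (a : F) → ¬ a ≡ 0F → ∃[ b ] a *F b ≡ 1F
    inverse a a≢0 with coprime-Bézout coprime
      where
        coprime : Coprime (toℕ a) p
        coprime (d∣a , d∣p) with prime⇒irreducible p-prime d∣p
        ... | inj₁ d≡1 = d≡1
        ... | inj₂ refl = ⊥-elim (a≢0 (p∣toℕ⇒≡0 a d∣a))
    ... | Bézout.+- x y eq = ι x , (begin
      a *F ι x              ≡⟨ cong (_*F ι x) (ι-toℕ a) ⟨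
      ι (toℕ a) *F ι x      ≡⟨ ι-* _ x ⟨
      ι (toℕ a ℕ.* x)       ≡⟨ cong ι (trans (ℕP.*-comm (toℕ a) x) (sym eq)) ⟩
      ι (1 ℕ.+ y ℕ.* p)     ≡⟨ ι-+ 1 _ ⟩
      1F +F ι (y ℕ.* p)     ≡⟨ cong (1F +F_) (p∣⇒ι≡0 _ (divides y refl)) ⟩
      1F +F 0F              ≡⟨ +F-identityʳ _ ⟩
      1F                    ∎)
    ... | Bézout.-+ x y eq = -F ι x , (begin
      a *F -F ι x           ≡⟨ Ring.solve 2 (λ a x → a :* (:- x) := :- (x :* a)) refl a (ι x) ⟩
      -F (ι x *F a)         ≡⟨ +-inverseˡ-unique 1F _ 1+xa≡0 ⟨
      1F                    ∎)
      where
        open Ring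
        1+xa≡0 : 1F +F ι x *F a ≡ 0F
        1+xa≡0 = begin
          1F +F ι x *F a            ≡⟨ cong (λ z → 1F +F ι x *F z) (ι-toℕ a) ⟨
          1F +F ι x *F ι (toℕ a)    ≡⟨ cong (1F +F_) (ι-* x _) ⟨
          1F +F ι (x ℕ.* toℕ a)     ≡⟨ ι-+ 1 _ ⟨
          ι (1 ℕ.+ x ℕ.* toℕ a)     ≡⟨ p∣⇒ι≡0 _ (divides y eq) ⟩
          0F                        ∎

    open Ring using (solve; _:+_; _:*_; :-_; _:=_)

    square-roots : ∀ y i → y *F y ≡ i *F i → y ≡ i ⊎ y ≡ -F i
    square-roots y i y²≡i² =
      [ inj₁ ∘ x∙y⁻¹≈ε⇒x≈y y i , inj₂ ∘ +-inverseˡ-unique y i ]′ (zero-divisor (y +F -F i) (y +F i) (begin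
        (y +F -F i) *F (y +F i)   ≡⟨ solve 2 (λ y i → (y :+ :- i) :* (y :+ i) := y :* y :+ :- (i :* i)) refl y i ⟩
        y *F y +F -F (i *F i)     ≡⟨ cong (λ z → z +F -F (i *F i)) y²≡i² ⟩
        i *F i +F -F (i *F i)     ≡⟨ -F-inverseʳ _ ⟩
        0F                        ∎))

    zero-or-nonzero : ∀ {P : F → Set} → P 0F → (∀ {a} → ¬ a ≡ 0F → P a) → ∀ a → P a
    zero-or-nonzero P0 P≢0 a with a Fin.≟ 0F
    ... | yes refl = P0
    ... | no a≢0   = P≢0 a≢0

    -- The total inverse (0⁻¹ = 0), so that inversion is an involution of F.
    inverse-or-0 : ∀ a → Dec (a ≡ 0F) → F
    inverse-or-0 a (yes _)   = 0F
    inverse-or-0 a (no a≢0)  = proj₁ (inverse a a≢0)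

    infix 9 _⁻¹
    _⁻¹ : F → F
    a ⁻¹ = inverse-or-0 a (a Fin.≟ 0F)

    ⁻¹-inverse : ∀ {a} → ¬ a ≡ 0F → a *F a ⁻¹ ≡ 1F
    ⁻¹-inverse {a} a≢0 = inverse-spec (a Fin.≟ 0F)
      where
        inverse-spec : (a≟0 : Dec (a ≡ 0F)) → a *F inverse-or-0 a a≟0 ≡ 1F
        inverse-spec (yes a≡0)  = ⊥-elim (a≢0 a≡0)
        inverse-spec (no a≢0′)  = proj₂ (inverse a a≢0′)

    0⁻¹ : 0F ⁻¹ ≡ 0F
    0⁻¹ = zero-spec (0F Fin.≟ 0F)
      where
        zero-spec : (0≟0 : Dec (0F ≡ 0F)) → inverse-or-0 0F 0≟0 ≡ 0F
        zero-spec (yes _)   = refl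
        zero-spec (no 0≢0)  = ⊥-elim (0≢0 refl)

    ⁻¹-unique : ∀ a {b} → a *F b ≡ 1F → a ⁻¹ ≡ b
    ⁻¹-unique a {b} ab≡1 = begin
      a ⁻¹                 ≡⟨ *F-identityʳ _ ⟨
      a ⁻¹ *F 1F           ≡⟨ cong (a ⁻¹ *F_) ab≡1 ⟨
      a ⁻¹ *F (a *F b)     ≡⟨ solve 3 (λ a a⁻¹ b → a⁻¹ :* (a :* b) := (a :* a⁻¹) :* b) refl a (a ⁻¹) b ⟩
      (a *F a ⁻¹) *F b     ≡⟨ cong (_*F b) (⁻¹-inverse a≢0) ⟩
      1F *F b              ≡⟨ *F-identityˡ b ⟩
      b                    ∎
      where
        a≢0 : ¬ a ≡ 0F
        a≢0 refl = 1F≢0F (trans (sym ab≡1) (zeroˡ b))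

    ⁻¹-nonzero : ∀ {a} → ¬ a ≡ 0F → ¬ a ⁻¹ ≡ 0F
    ⁻¹-nonzero {a} a≢0 a⁻¹≡0 =
      1F≢0F (trans (sym (⁻¹-inverse a≢0)) (trans (cong (a *F_) a⁻¹≡0) (zeroʳ a)))

    ⁻¹-involutive : ∀ a → a ⁻¹ ⁻¹ ≡ a
    ⁻¹-involutive = zero-or-nonzero (trans (cong _⁻¹ 0⁻¹) 0⁻¹)
      (λ {a} a≢0 → ⁻¹-unique (a ⁻¹) (trans (*F-comm _ a) (⁻¹-inverse a≢0)))

    -‿⁻¹-comm : ∀ a → -F (a ⁻¹) ≡ (-F a) ⁻¹
    -‿⁻¹-comm = zero-or-nonzero
      (trans (cong -F_ 0⁻¹) (trans -0#≈0# (sym (trans (cong _⁻¹ -0#≈0#) 0⁻¹))))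
      (λ {a} a≢0 → sym (⁻¹-unique (-F a) (trans (solve 2 (λ a b → (:- a) :* (:- b) := a :* b) refl a (a ⁻¹))
                                         (⁻¹-inverse a≢0))))

    module Odd (p≢2 : ¬ p ≡ 2) where

      2F≢0F : ¬ (2F {p}) ≡ 0F
      2F≢0F eq = p≢2 (ℕP.≤-antisym (∣⇒≤ (ι≡0⇒p∣ 2 eq)) (ℕ.nonTrivial⇒n>1 p {{prime⇒nonTrivial p-prime}}))

      double≡0 : ∀ y → y +F y ≡ 0F → y ≡ 0F
      double≡0 y y+y≡0 = [ ⊥-elim ∘ 2F≢0F , (λ y≡0 → y≡0) ]′
        (zero-divisor 2F y (trans (solve 1 (λ y → K 2 :* y := y :+ y) refl y) y+y≡0))

      odd : ¬ 2 ∣ p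
      odd 2∣p with prime⇒irreducible p-prime 2∣p
      ... | inj₁ ()
      ... | inj₂ 2≡p = p≢2 (sym 2≡p)

module MinusOne (p : ℕ) .{{_ : NonZero p}} (p-prime : Prime p) (p≢2 : ¬ p ≡ 2) where

  open PrimeField p
  open Field p-prime
  open Odd p≢2
  open Ring using (solve; _:+_; _:*_; :-_; _:=_)
  open ≡-Reasoning

  x≢-x : ∀ {x} → ¬ x ≡ 0F → ¬ x ≡ -F x
  x≢-x {x} x≢0 x≡-x = x≢0 (double≡0 x (trans (cong (x +F_) x≡-x) (-F-inverseʳ x)))

  0²≡0 : 0F *F 0F ≡ 0F
  0²≡0 = zeroˡ 0F

  1²≡1 : 1F *F 1F ≡ 1F
  1²≡1 = *F-identityˡ 1F

  [-1]²≡1 : -1F *F -1F ≡ 1F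
  [-1]²≡1 = solve 0 (:- K 1 :* :- K 1 := K 1) refl

  0≢1 : ¬ 0F ≡ 1F
  0≢1 = 1F≢0F ∘ sym

  0≢-1 : ¬ 0F ≡ -1F
  0≢-1 0≡-1 = 1F≢0F (trans (sym (-‿involutive 1F)) (trans (cong -F_ (sym 0≡-1)) -0#≈0#))

  1≢-1 : ¬ 1F ≡ -1F
  1≢-1 = x≢-x 1F≢0F

  ≡-⁻¹⇒²≡-1 : ∀ {y} → ¬ y ≡ 0F → y ≡ -F (y ⁻¹) → y *F y ≡ -1F
  ≡-⁻¹⇒²≡-1 {y} y≢0 y≡-y⁻¹ = begin
    y *F y               ≡⟨ cong (y *F_) y≡-y⁻¹ ⟩
    y *F -F (y ⁻¹)       ≡⟨ solve 2 (λ y z → y :* (:- z) := :- (y :* z)) refl y (y ⁻¹) ⟩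
    -F (y *F y ⁻¹)       ≡⟨ cong -F_ (⁻¹-inverse y≢0) ⟩
    -1F                  ∎

  open KleinOrbits Fin._≟_ -F_ _⁻¹ -‿involutive ⁻¹-involutive -‿⁻¹-comm

  free-orbit : ∀ {y} → ¬ y ≡ 0F → ¬ y ≡ 1F → ¬ y ≡ -1F → ¬ y *F y ≡ -1F → Free y
  free-orbit {y} y≢0 y≢1 y≢-1 y²≢-1 =
    (x≢-x y≢0 ∷ y≢y⁻¹ ∷ y≢-y⁻¹ ∷ []) ∷
    (-y≢y⁻¹ ∷ y≢y⁻¹ ∘ -‿injective ∷ []) ∷
    (x≢-x (⁻¹-nonzero y≢0) ∷ []) ∷ [] ∷ []
    where
      y≢y⁻¹ : ¬ y ≡ y ⁻¹
      y≢y⁻¹ y≡y⁻¹ = [ y≢1 , y≢-1 ]′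
        (square-roots y 1F (trans (cong (y *F_) y≡y⁻¹) (trans (⁻¹-inverse y≢0) (sym 1²≡1))))
      y≢-y⁻¹ : ¬ y ≡ -F (y ⁻¹)
      y≢-y⁻¹ = y²≢-1 ∘ ≡-⁻¹⇒²≡-1 y≢0
      -y≢y⁻¹ : ¬ -F y ≡ y ⁻¹
      -y≢y⁻¹ -y≡y⁻¹ = y≢-y⁻¹ (trans (sym (-‿involutive y)) (cong -F_ -y≡y⁻¹))

  length-allFin : length (allFin p) ≡ p
  length-allFin = length-tabulate (λ x → x)

  p≡|E| : ∀ {E} → Unique E → Closed -F_ E → Closed _⁻¹ E → (∀ {y} → y ∉ E → Free y) →
    p % 4 ≡ length E % 4
  p≡|E| unique closed-neg closed-inv free = trans (cong (_% 4) (sym length-allFin))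
    (length-mod4 unique (Unique.allFin⁺ p) ∈-allFin closed-neg closed-inv free)

  -- If −1 is not a square, F ∖ {0, ±1} is a union of free orbits: p ≡ 3 (mod 4).
  no-√-1⇒p≡3 : (∀ i → ¬ i *F i ≡ -1F) → p % 4 ≡ 3
  no-√-1⇒p≡3 no-√-1 = p≡|E| {E} unique closed-neg closed-inv free
    where
      E : List F
      E = 0F ∷ 1F ∷ -1F ∷ []
      unique : Unique E
      unique = (0≢1 ∷ 0≢-1 ∷ []) ∷ (1≢-1 ∷ []) ∷ [] ∷ []
      closed-neg : Closed -F_ E
      closed-neg (here refl)                 = here -0#≈0#
      closed-neg (there (here refl))         = there (there (here refl))
      closed-neg (there (there (here refl))) = there (here (-‿involutive 1F))
      closed-inv : Closed _⁻¹ E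
      closed-inv (here refl)                 = here 0⁻¹
      closed-inv (there (here refl))         = there (here (⁻¹-unique 1F 1²≡1))
      closed-inv (there (there (here refl))) = there (there (here (⁻¹-unique -1F [-1]²≡1)))
      free : ∀ {y} → y ∉ E → Free y
      free {y} y∉E = free-orbit (y∉E ∘ here) (y∉E ∘ there ∘ here) (y∉E ∘ there ∘ there ∘ here) (no-√-1 y)

  ≢-by-squares : ∀ {x y a b} → x *F x ≡ a → y *F y ≡ b → ¬ a ≡ b → ¬ x ≡ y
  ≢-by-squares refl refl a≢b refl = a≢b refl

  -- If i² = −1, F ∖ {0, ±1, ±i} is a union of free orbits: p ≡ 1 (mod 4).
  √-1⇒p≡1 : ∀ i → i *F i ≡ -1F → p % 4 ≡ 1
  √-1⇒p≡1 i i²≡-1 = p≡|E| {E} unique closed-neg closed-inv free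
    where
      [-i]²≡-1 : -F i *F -F i ≡ -1F
      [-i]²≡-1 = trans (solve 1 (λ i → :- i :* :- i := i :* i) refl i) i²≡-1
      i·[-i]≡1 : i *F -F i ≡ 1F
      i·[-i]≡1 = begin
        i *F -F i      ≡⟨ solve 1 (λ i → i :* :- i := :- (i :* i)) refl i ⟩
        -F (i *F i)    ≡⟨ cong -F_ i²≡-1 ⟩
        -F -1F         ≡⟨ -‿involutive 1F ⟩
        1F             ∎
      E : List F
      E = 0F ∷ 1F ∷ -1F ∷ i ∷ -F i ∷ []
      unique : Unique E
      unique =
        (0≢1 ∷ 0≢-1 ∷ ≢-by-squares 0²≡0 i²≡-1 0≢-1 ∷ ≢-by-squares 0²≡0 [-i]²≡-1 0≢-1 ∷ []) ∷
        (1≢-1 ∷ ≢-by-squares 1²≡1 i²≡-1 1≢-1 ∷ ≢-by-squares 1²≡1 [-i]²≡-1 1≢-1 ∷ []) ∷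
        (≢-by-squares [-1]²≡1 i²≡-1 1≢-1 ∷ ≢-by-squares [-1]²≡1 [-i]²≡-1 1≢-1 ∷ []) ∷
        (x≢-x (≢-by-squares i²≡-1 0²≡0 (0≢-1 ∘ sym)) ∷ []) ∷ [] ∷ []
      closed-neg : Closed -F_ E
      closed-neg (here refl)                                 = here -0#≈0#
      closed-neg (there (here refl))                         = there (there (here refl))
      closed-neg (there (there (here refl)))                 = there (here (-‿involutive 1F))
      closed-neg (there (there (there (here refl))))         = there (there (there (there (here refl))))
      closed-neg (there (there (there (there (here refl))))) = there (there (there (here (-‿involutive i))))
      closed-inv : Closed _⁻¹ E
      closed-inv (here refl)                                 = here 0⁻¹
      closed-inv (there (here refl))                         = there (here (⁻¹-unique 1F 1²≡1))
      closed-inv (there (there (here refl)))                 = there (there (here (⁻¹-unique -1F [-1]²≡1)))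
      closed-inv (there (there (there (here refl))))         =
        there (there (there (there (here (⁻¹-unique i i·[-i]≡1)))))
      closed-inv (there (there (there (there (here refl))))) =
        there (there (there (here (⁻¹-unique (-F i) (trans (*F-comm (-F i) i) i·[-i]≡1)))))
      free : ∀ {y} → y ∉ E → Free y
      free {y} y∉E = free-orbit (y∉E ∘ here) (y∉E ∘ there ∘ here) (y∉E ∘ there ∘ there ∘ here) y²≢-1
        where
          y²≢-1 : ¬ y *F y ≡ -1F
          y²≢-1 y²≡-1 =
            [ y∉E ∘ there ∘ there ∘ there ∘ here , y∉E ∘ there ∘ there ∘ there ∘ there ∘ here ]′
              (square-roots y i (trans y²≡-1 (sym i²≡-1)))

module Anisotropy (p : ℕ) .{{_ : NonZero p}} (p-prime : Prime p) (p≢2 : ¬ p ≡ 2)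
    (c : Fin p) (c≢0 : ¬ c ≡ 0F)
    (p≡1⇒c-nonsquare : p % 4 ≡ 1 → ¬ IsSquare c) (p≡3⇒c-square : p % 4 ≡ 3 → IsSquare c) where

  open PrimeField p
  open Field p-prime
  open Odd p≢2
  open Ring using (solve; _:+_; _:*_; :-_; _:=_)
  open ≡-Reasoning
  open MinusOne p p-prime p≢2

  -c-nonsquare : ∀ w → ¬ w *F w ≡ -F c
  -c-nonsquare w w²≡-c = [ p≡1-case , p≡3-case ]′ (odd⇒1or3mod4 p odd)
    where
      -- if i² = −1 then (i w)² = c, so c nonsquare forces −1 nonsquare and p ≡ 3
      p≡1-case : ¬ p % 4 ≡ 1
      p≡1-case p≡1 = 3≢1 (trans (sym (no-√-1⇒p≡3 (λ i → p≡1⇒c-nonsquare p≡1 ∘ iw-root i))) p≡1)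
        where
          3≢1 : ¬ 3 ≡ 1
          3≢1 ()
          iw-root : ∀ i → i *F i ≡ -1F → IsSquare c
          iw-root i i²≡-1 = i *F w , (begin
            (i *F w) *F (i *F w)    ≡⟨ solve 2 (λ i w → (i :* w) :* (i :* w) := (i :* i) :* (w :* w)) refl i w ⟩
            (i *F i) *F (w *F w)    ≡⟨ cong₂ _*F_ i²≡-1 w²≡-c ⟩
            -1F *F -F c             ≡⟨ solve 1 (λ c → :- K 1 :* :- c := c) refl c ⟩
            c                       ∎)
      -- if c = s² then (w / s)² = −1, forcing p ≡ 1
      square-case : IsSquare c → p % 4 ≡ 1
      square-case (s , s²≡c) = √-1⇒p≡1 (w *F s ⁻¹) (begin
        (w *F s ⁻¹) *F (w *F s ⁻¹)
          ≡⟨ solve 2 (λ w t → (w :* t) :* (w :* t) := (w :* w) :* (t :* t)) refl w (s ⁻¹) ⟩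
        (w *F w) *F (s ⁻¹ *F s ⁻¹)
          ≡⟨ cong (λ x → x *F (s ⁻¹ *F s ⁻¹)) (trans w²≡-c (cong -F_ (sym s²≡c))) ⟩
        -F (s *F s) *F (s ⁻¹ *F s ⁻¹)
          ≡⟨ solve 2 (λ s t → :- (s :* s) :* (t :* t) := :- ((s :* t) :* (s :* t))) refl s (s ⁻¹) ⟩
        -F ((s *F s ⁻¹) *F (s *F s ⁻¹))
          ≡⟨ cong (λ x → -F (x *F x)) (⁻¹-inverse s≢0) ⟩
        -F (1F *F 1F)
          ≡⟨ cong -F_ 1²≡1 ⟩
        -1F ∎)
        where
          s≢0 : ¬ s ≡ 0F
          s≢0 refl = c≢0 (trans (sym s²≡c) 0²≡0)
      p≡3-case : ¬ p % 4 ≡ 3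
      p≡3-case p≡3 = 1≢3 (trans (sym (square-case (p≡3⇒c-square p≡3))) p≡3)
        where
          1≢3 : ¬ 1 ≡ 3
          1≢3 ()

  anisotropic : ∀ y z → y *F y +F c *F (z *F z) ≡ 0F → y ≡ 0F × z ≡ 0F
  anisotropic y = zero-or-nonzero z≡0-case z≢0-case
    where
      z≡0-case : y *F y +F c *F (0F *F 0F) ≡ 0F → y ≡ 0F × 0F ≡ 0F
      z≡0-case N≡0 =
        square≡0 y (trans (solve 2 (λ y c → y :* y := y :* y :+ c :* (K 0 :* K 0)) refl y c) N≡0) , refl
      -- for z ≠ 0, (y / z)² = −c
      z≢0-case : ∀ {z} → ¬ z ≡ 0F → y *F y +F c *F (z *F z) ≡ 0F → y ≡ 0F × z ≡ 0F
      z≢0-case {z} z≢0 N≡0 = ⊥-elim (-c-nonsquare (y *F z ⁻¹) (begin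
        (y *F z ⁻¹) *F (y *F z ⁻¹)
          ≡⟨ solve 4 (λ y z t c → (y :* t) :* (y :* t)
                                 := (y :* y :+ c :* (z :* z)) :* (t :* t) :+ :- c :* ((z :* t) :* (z :* t)))
                     refl y z (z ⁻¹) c ⟩
        (y *F y +F c *F (z *F z)) *F (z ⁻¹ *F z ⁻¹) +F -F c *F ((z *F z ⁻¹) *F (z *F z ⁻¹))
          ≡⟨ cong₂ (λ a b → a *F (z ⁻¹ *F z ⁻¹) +F -F c *F (b *F b)) N≡0 (⁻¹-inverse z≢0) ⟩
        0F *F (z ⁻¹ *F z ⁻¹) +F -F c *F (1F *F 1F)
          ≡⟨ solve 2 (λ t c → K 0 :* (t :* t) :+ :- c :* (K 1 :* K 1) := :- c) refl (z ⁻¹) c ⟩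
        -F c ∎))

module Secant (p : ℕ) .{{_ : NonZero p}} (p-prime : Prime p) (p≢2 : ¬ p ≡ 2)
    (c : Fin p) (anisotropic : ∀ y z → y *F y +F c *F (z *F z) ≡ 0F → y ≡ 0F × z ≡ 0F)
    (β : Fin p) (β≢0 : ¬ β ≡ 0F) (P₂ P₃ Q₂ Q₃ : Fin p)
    (P∈O : OnConic c β (1F , P₂ , P₃)) (Q∈O : OnConic c β (1F , Q₂ , Q₃))
    (P≢Q : ¬ (P₂ ≡ Q₂ × P₃ ≡ Q₃))
    (O∉PQ : ¬ OnLine (1F , P₂ , P₃) (1F , Q₂ , Q₃) (1F , 0F , 0F)) where

  open PrimeField p
  open Field p-prime
  open Odd p≢2
  open Ring using (solve; _:+_; _:*_; :-_; _:=_)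
  open ≡-Reasoning

  P Q T : V3
  P = (1F , P₂ , P₃)
  Q = (1F , Q₂ , Q₃)
  T = (2F , P₂ +F Q₂ , P₃ +F Q₃)

  N : F → F → F
  N y z = y *F y +F c *F (z *F z)

  conic : F → V3 → F
  conic k (x , y , z) = x *F x +F k *F (y *F y) +F c *F k *F (z *F z)

  g : F
  g = P₂ *F Q₂ +F c *F (P₃ *F Q₃)

  -- d = 1 − βg; the conic tangent to PQ will be O_α with α = 2β / d
  d : F
  d = 1F +F -F (β *F g)

  cancel-β : ∀ u → β *F u ≡ 0F → u ≡ 0F
  cancel-β u βu≡0 = [ ⊥-elim ∘ β≢0 , (λ u≡0 → u≡0) ]′ (zero-divisor β u βu≡0)

  -2x≡0 : ∀ {x} → x ≡ 0F → -F (2F *F x) ≡ 0F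
  -2x≡0 refl = trans (cong -F_ (zeroʳ 2F)) -0#≈0#

  βN≡-1 : ∀ y z → OnConic c β (1F , y , z) → β *F N y z ≡ -1F
  βN≡-1 y z on = begin
    β *F N y z                                                   ≡⟨ solve 4 (λ β c y z →
        β :* (y :* y :+ c :* (z :* z)) := (K 1 :* K 1 :+ β :* (y :* y) :+ c :* β :* (z :* z)) :+ :- K 1) refl β c y z ⟩
    1F *F 1F +F β *F (y *F y) +F c *F β *F (z *F z) +F -1F      ≡⟨ cong (_+F -1F) on ⟩
    0F +F -1F                                                    ≡⟨ +F-identityˡ _ ⟩
    -1F                                                          ∎

  -- N is a quadratic form with polar form g; on O_β, β N(P) = β N(Q) = −1 and
  -- β g = 1 − d, hence β N(sP + tQ) = −s² − t² + 2st(1 − d).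
  βN-on-line : ∀ s t → β *F N (s *F P₂ +F t *F Q₂) (s *F P₃ +F t *F Q₃)
                       ≡ -F (s *F s) +F -F (t *F t) +F 2F *F s *F t *F (1F +F -F d)
  βN-on-line s t = begin
    β *F N (s *F P₂ +F t *F Q₂) (s *F P₃ +F t *F Q₃)
      ≡⟨ solve 8 (λ β c s t P₂ P₃ Q₂ Q₃ →
           β :* ((s :* P₂ :+ t :* Q₂) :* (s :* P₂ :+ t :* Q₂) :+ c :* ((s :* P₃ :+ t :* Q₃) :* (s :* P₃ :+ t :* Q₃)))
           := s :* s :* (β :* (P₂ :* P₂ :+ c :* (P₃ :* P₃))) :+ t :* t :* (β :* (Q₂ :* Q₂ :+ c :* (Q₃ :* Q₃)))
              :+ K 2 :* s :* t :* (β :* (P₂ :* Q₂ :+ c :* (P₃ :* Q₃))))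
         refl β c s t P₂ P₃ Q₂ Q₃ ⟩
    s *F s *F (β *F N P₂ P₃) +F t *F t *F (β *F N Q₂ Q₃) +F 2F *F s *F t *F (β *F g)
      ≡⟨ cong₂ (λ u v → s *F s *F u +F t *F t *F v +F 2F *F s *F t *F (β *F g))
               (βN≡-1 P₂ P₃ P∈O) (βN≡-1 Q₂ Q₃ Q∈O) ⟩
    s *F s *F -1F +F t *F t *F -1F +F 2F *F s *F t *F (β *F g)
      ≡⟨ solve 3 (λ s t x → s :* s :* (:- K 1) :+ t :* t :* (:- K 1) :+ K 2 :* s :* t :* x
                         := :- (s :* s) :+ :- (t :* t) :+ K 2 :* s :* t :* (K 1 :+ :- (K 1 :+ :- x)))
         refl s t (β *F g) ⟩
    -F (s *F s) +F -F (t *F t) +F 2F *F s *F t *F (1F +F -F d) ∎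

  βN[P+Q] : β *F N (P₂ +F Q₂) (P₃ +F Q₃) ≡ -F (2F *F d)
  βN[P+Q] = begin
    β *F N (P₂ +F Q₂) (P₃ +F Q₃)
      ≡⟨ cong₂ (λ y z → β *F N y z) (1P+1Q P₂ Q₂) (1P+1Q P₃ Q₃) ⟩
    β *F N (1F *F P₂ +F 1F *F Q₂) (1F *F P₃ +F 1F *F Q₃)
      ≡⟨ βN-on-line 1F 1F ⟩
    -F (1F *F 1F) +F -F (1F *F 1F) +F 2F *F 1F *F 1F *F (1F +F -F d)
      ≡⟨ solve 1 (λ d → :- (K 1 :* K 1) :+ :- (K 1 :* K 1) :+ K 2 :* K 1 :* K 1 :* (K 1 :+ :- d)
                      := :- (K 2 :* d)) refl d ⟩
    -F (2F *F d) ∎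
    where
      1P+1Q : ∀ a b → a +F b ≡ 1F *F a +F 1F *F b
      1P+1Q a b = solve 2 (λ a b → a :+ b := K 1 :* a :+ K 1 :* b) refl a b

  βN[P-Q] : β *F N (P₂ +F -F Q₂) (P₃ +F -F Q₃) ≡ -F (2F *F (2F +F -F d))
  βN[P-Q] = begin
    β *F N (P₂ +F -F Q₂) (P₃ +F -F Q₃)
      ≡⟨ cong₂ (λ y z → β *F N y z) (1P-1Q P₂ Q₂) (1P-1Q P₃ Q₃) ⟩
    β *F N (1F *F P₂ +F -1F *F Q₂) (1F *F P₃ +F -1F *F Q₃)
      ≡⟨ βN-on-line 1F -1F ⟩
    -F (1F *F 1F) +F -F (-1F *F -1F) +F 2F *F 1F *F -1F *F (1F +F -F d)
      ≡⟨ solve 1 (λ d → :- (K 1 :* K 1) :+ :- (:- K 1 :* :- K 1) :+ K 2 :* K 1 :* :- K 1 :* (K 1 :+ :- d)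
                      := :- (K 2 :* (K 2 :+ :- d))) refl d ⟩
    -F (2F *F (2F +F -F d)) ∎
    where
      1P-1Q : ∀ a b → a +F -F b ≡ 1F *F a +F -1F *F b
      1P-1Q a b = solve 2 (λ a b → a :+ :- b := K 1 :* a :+ :- K 1 :* b) refl a b

  sP+sQ≡sT : ∀ s → addV (scale s P) (scale s Q) ≡ scale s T
  sP+sQ≡sT s = cong₂ _,_ (solve 1 (λ s → s :* K 1 :+ s :* K 1 := s :* K 2) refl s)
    (cong₂ _,_ (solve 3 (λ s a b → s :* a :+ s :* b := s :* (a :+ b)) refl s P₂ Q₂)
               (solve 3 (λ s a b → s :* a :+ s :* b := s :* (a :+ b)) refl s P₃ Q₃))

  -- d ≠ 0: otherwise N(P + Q) = 0, so P + Q = (2, 0, 0) and (1, 0, 0) would lie on PQ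
  d≢0 : ¬ d ≡ 0F
  d≢0 d≡0 = O∉PQ (h , h , (begin
    (1F , 0F , 0F)                ≡⟨ cong₂ _,_ (sym h·2≡1) (cong₂ _,_ (h·≡0 P₂+Q₂≡0) (h·≡0 P₃+Q₃≡0)) ⟩
    scale h T                     ≡⟨ sP+sQ≡sT h ⟨
    addV (scale h P) (scale h Q)  ∎))
    where
      N[P+Q]≡0 : N (P₂ +F Q₂) (P₃ +F Q₃) ≡ 0F
      N[P+Q]≡0 = cancel-β (N (P₂ +F Q₂) (P₃ +F Q₃)) (trans βN[P+Q] (-2x≡0 d≡0))
      P₂+Q₂≡0 : P₂ +F Q₂ ≡ 0F
      P₂+Q₂≡0 = proj₁ (anisotropic (P₂ +F Q₂) (P₃ +F Q₃) N[P+Q]≡0)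
      P₃+Q₃≡0 : P₃ +F Q₃ ≡ 0F
      P₃+Q₃≡0 = proj₂ (anisotropic (P₂ +F Q₂) (P₃ +F Q₃) N[P+Q]≡0)
      h : F
      h = 2F ⁻¹
      h·2≡1 : h *F 2F ≡ 1F
      h·2≡1 = trans (*F-comm h 2F) (⁻¹-inverse 2F≢0F)
      h·≡0 : ∀ {x} → x ≡ 0F → 0F ≡ h *F x
      h·≡0 refl = sym (zeroʳ h)

  α : F
  α = 2F *F β *F d ⁻¹

  α·d≡2β : α *F d ≡ 2F *F β
  α·d≡2β = begin
    2F *F β *F d ⁻¹ *F d   ≡⟨ *F-assoc (2F *F β) (d ⁻¹) d ⟩
    2F *F β *F (d ⁻¹ *F d) ≡⟨ cong (2F *F β *F_) (trans (*F-comm (d ⁻¹) d) (⁻¹-inverse d≢0)) ⟩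
    2F *F β *F 1F          ≡⟨ *F-identityʳ _ ⟩
    2F *F β                ∎

  α≢0 : ¬ α ≡ 0F
  α≢0 = *F-nonzero {2F *F β} {d ⁻¹} (*F-nonzero {2F} {β} 2F≢0F β≢0) (⁻¹-nonzero d≢0)

  -- α ≠ β: otherwise d = 2, so N(P − Q) = 0 and P = Q
  α≢β : ¬ α ≡ β
  α≢β α≡β = P≢Q (x∙y⁻¹≈ε⇒x≈y P₂ Q₂ (proj₁ P-Q≡0) , x∙y⁻¹≈ε⇒x≈y P₃ Q₃ (proj₂ P-Q≡0))
    where
      2-d≡0 : 2F +F -F d ≡ 0F
      2-d≡0 = cancel-β (2F +F -F d) (begin
        β *F (2F +F -F d)
          ≡⟨ solve 3 (λ β d α → β :* (K 2 :+ :- d) := K 2 :* β :+ :- (α :* d) :+ (α :+ :- β) :* d)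
                   refl β d α ⟩
        2F *F β +F -F (α *F d) +F (α +F -F β) *F d
          ≡⟨ cong₂ (λ x y → 2F *F β +F -F x +F (y +F -F β) *F d) α·d≡2β α≡β ⟩
        2F *F β +F -F (2F *F β) +F (β +F -F β) *F d
          ≡⟨ solve 3 (λ β d x → x :+ :- x :+ (β :+ :- β) :* d := K 0) refl β d (2F *F β) ⟩
        0F ∎)
      P-Q≡0 : P₂ +F -F Q₂ ≡ 0F × P₃ +F -F Q₃ ≡ 0F
      P-Q≡0 = anisotropic (P₂ +F -F Q₂) (P₃ +F -F Q₃)
        (cancel-β (N (P₂ +F -F Q₂) (P₃ +F -F Q₃)) (trans βN[P-Q] (-2x≡0 2-d≡0)))

  -- Key identity: restricted to the line sP + tQ, β times the form of O_α is
  -- (β − α)(s − t)².  So PQ meets O_α only where s = t, i.e. at T.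
  restriction : ∀ s t → β *F conic α (addV (scale s P) (scale t Q))
                        ≡ (β +F -F α) *F ((s +F -F t) *F (s +F -F t))
  restriction s t = begin
    β *F conic α (addV (scale s P) (scale t Q))
      ≡⟨ solve 9 (λ β α c s t P₂ P₃ Q₂ Q₃ →
           β :* ((s :* K 1 :+ t :* K 1) :* (s :* K 1 :+ t :* K 1)
                 :+ α :* ((s :* P₂ :+ t :* Q₂) :* (s :* P₂ :+ t :* Q₂))
                 :+ c :* α :* ((s :* P₃ :+ t :* Q₃) :* (s :* P₃ :+ t :* Q₃)))
           := β :* ((s :+ t) :* (s :+ t))
              :+ α :* (β :* ((s :* P₂ :+ t :* Q₂) :* (s :* P₂ :+ t :* Q₂)
                             :+ c :* ((s :* P₃ :+ t :* Q₃) :* (s :* P₃ :+ t :* Q₃)))))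
         refl β α c s t P₂ P₃ Q₂ Q₃ ⟩
    β *F ((s +F t) *F (s +F t)) +F α *F (β *F N (s *F P₂ +F t *F Q₂) (s *F P₃ +F t *F Q₃))
      ≡⟨ cong (λ u → β *F ((s +F t) *F (s +F t)) +F α *F u) (βN-on-line s t) ⟩
    β *F ((s +F t) *F (s +F t)) +F α *F (-F (s *F s) +F -F (t *F t) +F 2F *F s *F t *F (1F +F -F d))
      ≡⟨ solve 5 (λ β α d s t →
           β :* ((s :+ t) :* (s :+ t)) :+ α :* (:- (s :* s) :+ :- (t :* t) :+ K 2 :* s :* t :* (K 1 :+ :- d))
           := (β :+ :- α) :* ((s :+ :- t) :* (s :+ :- t)) :+ K 2 :* s :* t :* (K 2 :* β :+ :- (α :* d)))
         refl β α d s t ⟩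
    (β +F -F α) *F ((s +F -F t) *F (s +F -F t)) +F 2F *F s *F t *F (2F *F β +F -F (α *F d))
      ≡⟨ cong (λ w → (β +F -F α) *F ((s +F -F t) *F (s +F -F t)) +F 2F *F s *F t *F (2F *F β +F -F w))
              α·d≡2β ⟩
    (β +F -F α) *F ((s +F -F t) *F (s +F -F t)) +F 2F *F s *F t *F (2F *F β +F -F (2F *F β))
      ≡⟨ solve 4 (λ x s t y → x :+ K 2 :* s :* t :* (y :+ :- y) := x) refl
           ((β +F -F α) *F ((s +F -F t) *F (s +F -F t))) s t (2F *F β) ⟩
    (β +F -F α) *F ((s +F -F t) *F (s +F -F t)) ∎

  on-O_α⇒s≡t : ∀ s t → conic α (addV (scale s P) (scale t Q)) ≡ 0F → s ≡ t
  on-O_α⇒s≡t s t X∈O_α =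
    [ (λ β-α≡0 → ⊥-elim (α≢β (sym (x∙y⁻¹≈ε⇒x≈y β α β-α≡0))))
    , (λ [s-t]²≡0 → x∙y⁻¹≈ε⇒x≈y s t (square≡0 (s +F -F t) [s-t]²≡0)) ]′
    (zero-divisor (β +F -F α) ((s +F -F t) *F (s +F -F t))
      (trans (sym (restriction s t)) (trans (cong (β *F_) X∈O_α) (zeroʳ β))))

  T≡P+Q : T ≡ addV (scale 1F P) (scale 1F Q)
  T≡P+Q = sym (trans (sP+sQ≡sT 1F)
    (cong₂ _,_ (*F-identityˡ 2F) (cong₂ _,_ (*F-identityˡ (P₂ +F Q₂)) (*F-identityˡ (P₃ +F Q₃)))))

  T∈O_α : conic α T ≡ 0F
  T∈O_α = cancel-β (conic α T) (begin
    β *F conic α T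
      ≡⟨ cong (λ X → β *F conic α X) T≡P+Q ⟩
    β *F conic α (addV (scale 1F P) (scale 1F Q))
      ≡⟨ restriction 1F 1F ⟩
    (β +F -F α) *F ((1F +F -F 1F) *F (1F +F -F 1F))
      ≡⟨ solve 1 (λ x → x :* ((K 1 :+ :- K 1) :* (K 1 :+ :- K 1)) := K 0) refl (β +F -F α) ⟩
    0F ∎)

  tangent : TangentAt c α P Q T
  tangent = (λ { (2≡0 , _) → 2F≢0F 2≡0 }) , (1F , 1F , T≡P+Q) , T∈O_α , only-T
    where
      only-T : ∀ X → NonZeroV X → OnLine P Q X → OnConic c α X → SamePoint T X
      only-T X X≢0 (s , t , X≡sP+tQ) X∈O_α = s , s≢0 , X≡sT
        where
          s≡t : s ≡ t
          s≡t = on-O_α⇒s≡t s t (subst (λ Y → conic α Y ≡ 0F) X≡sP+tQ X∈O_α)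
          X≡sT : X ≡ scale s T
          X≡sT = begin
            X                             ≡⟨ X≡sP+tQ ⟩
            addV (scale s P) (scale t Q)  ≡⟨ cong (λ u → addV (scale s P) (scale u Q)) s≡t ⟨
            addV (scale s P) (scale s Q)  ≡⟨ sP+sQ≡sT s ⟩
            scale s T                     ∎
          s≢0 : ¬ s ≡ 0F
          s≢0 refl = X≢0 (cong proj₁ X≡0 , cong (proj₁ ∘ proj₂) X≡0 , cong (proj₂ ∘ proj₂) X≡0)
            where
              X≡0 : X ≡ (0F , 0F , 0F)
              X≡0 = trans X≡sT (cong₂ _,_ (zeroˡ 2F) (cong₂ _,_ (zeroˡ (P₂ +F Q₂)) (zeroˡ (P₃ +F Q₃))))

mainTheorem11 : (p : ℕ) .{{_ : NonZero p}} → Prime p → ¬ p ≡ 2 →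
  (c : Fin p) → ¬ c ≡ 0F →
  (p % 4 ≡ 1 → ¬ IsSquare c) → (p % 4 ≡ 3 → IsSquare c) →
  (β : Fin p) → ¬ β ≡ 0F →
  (P₂ P₃ Q₂ Q₃ : Fin p) →
  OnConic c β (1F , P₂ , P₃) → OnConic c β (1F , Q₂ , Q₃) →
  ¬ (P₂ ≡ Q₂ × P₃ ≡ Q₃) →
  ¬ OnLine (1F , P₂ , P₃) (1F , Q₂ , Q₃) (1F , 0F , 0F) →
  ∃[ α ] (¬ α ≡ 0F × ¬ α ≡ β ×
    TangentAt c α (1F , P₂ , P₃) (1F , Q₂ , Q₃) (2F , P₂ +F Q₂ , P₃ +F Q₃))
mainTheorem11 p p-prime p≢2 c c≢0 p≡1⇒c-nonsquare p≡3⇒c-square β β≢0 P₂ P₃ Q₂ Q₃ P∈O Q∈O P≢Q O∉PQ =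
  α , α≢0 , α≢β , tangent
  where
    open Anisotropy p p-prime p≢2 c c≢0 p≡1⇒c-nonsquare p≡3⇒c-square using (anisotropic)
    open Secant p p-prime p≢2 c anisotropic β β≢0 P₂ P₃ Q₂ Q₃ P∈O Q∈O P≢Q O∉PQ
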